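{- Let $R$ be a consistent triple set with $ab|c\in\mathrm{cl}(R)$. Let $\{A^*,B^*\}\in\mathfrak L(ab|c;R)$ satisfy $|A^*\cup B^*|\ge|A\cup B|$ for all $\{A,B\}\in\mathfrak L(ab|c;R)$. Then for every $\{A,B\}\in\mathfrak L(ab|c;R)$, either $A\subseteq A^*$ and $B\subseteq B^*$, or $B\subseteq A^*$ and $A\subseteq B^*$. Moreover, the element $\{A^*,B^*\}$ of $\mathfrak L(ab|c;R)$ with $|A^*\cup B^*|\ge|A\cup B|$ for all $\{A,B\}\in\mathfrak L(ab|c;R)$ is unique.
   Context: A rooted tree $T$ has a distinguished inner vertex (root); leaves are degree-1 vertices; inner vertices other than the root have degree at least 3. A triple $ab|c$ is the rooted binary tree on leaves $a,b,c$ where the path from $a$ to $b$ avoids the path from $c$ to the root; $ab|c=ba|c$. A rooted tree displays $ab|c$ if $a,b,c$ are leaves and the path from $a$ to $b$ does not intersect the path from $c$ to the root; $\mathcal R(T)$ is the set of displayed triples. A triple set is consistent if some rooted tree displays all its triples. $L_R$ is the set of leaves appearing in $R$. $\mathrm{cl}(R)=\bigcap\mathcal R(T)$ over all rooted trees $T$ with leaf set $L_R$ displaying $R$. For $\mathcal L\subseteq L_R$, the Ahograph $[R,\mathcal L]$ has vertex set $\mathcal L$, distinct $x,y\in\mathcal L$ adjacent iff some $xy|z\in R$ has $z\in\mathcal L$; connected components are identified with vertex sets. For a triple $ab|c$ with $a,b,c\in L_R$, $\mathfrak L(ab|c;R)$ is the set of all unordered pairs $\{A,B\}$ with $A,B\subseteq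 L_R$ such that $[R,A\cup B]$ has exactly two connected components, $A$ and $B$, one containing $a$ and $b$ and the other containing $c$ (it is nonempty when $ab|c\in\mathrm{cl}(R)$). -}

module Defs where

open import Data.Nat using (ℕ; _≤_)
open import Data.Fin using (Fin)
open import Data.Fin.Subset as S using (Subset; _∪_; ∣_∣; Nonempty)
  renaming (_∈_ to _∈ₛ_; _∉_ to _∉ₛ_; _⊆_ to _⊆ₛ_)
open import Data.List using (List; []; _∷_; _++_; length)
open import Data.List.Membership.Propositional using (_∈_; _∉_)
open import Data.List.Relation.Unary.Any using (Any)
open import Data.List.Relation.Unary.Unique.Propositional using (Unique)
open import Data.Product using (_×_; ∃; ∃-syntax; Σ-syntax)
open import Data.Sum using (_⊎_)
open import Relation.Binary.PropositionalEquality using (_≡_; _≢_)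
open import Relation.Binary.Construct.Closure.ReflexiveTransitive using (Star)
open import Relation.Nullary using (¬_)
open import Data.Empty using (⊥)
open import Data.Unit using (⊤)

-- A triple  ab|c  (with ab|c = ba|c handled by `TripleIn`).
record Triple (n : ℕ) : Set where
  constructor _∣∣_∣_
  field
    a b c : Fin n
open Triple public

TripleIn : ∀ {n} → List (Triple n) → Fin n → Fin n → Fin n → Set
TripleIn R x y z =
  Any (λ t → ((a t ≡ x × b t ≡ y) ⊎ (a t ≡ y × b t ≡ x)) × c t ≡ z) R

InLR : ∀ {n} → List (Triple n) → Fin n → Set
InLR R x = Any (λ t → a t ≡ x ⊎ b t ≡ x ⊎ c t ≡ x) R

-- Rooted trees with leaves labelled by Fin n.  Every inner vertex has at
-- least two children (non-root inner vertices have degree ≥ 3, and the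
-- root, being an inner vertex, is not of degree 1).

data Tree (n : ℕ) : Set where
  leaf : Fin n → Tree n
  node : (ts : List (Tree n)) → 2 ≤ length ts → Tree n

mutual
  leaves : ∀ {n} → Tree n → List (Fin n)
  leaves (leaf x)   = x ∷ []
  leaves (node ts _) = leavesL ts

  leavesL : ∀ {n} → List (Tree n) → List (Fin n)
  leavesL []       = []
  leavesL (t ∷ ts) = leaves t ++ leavesL ts

IsNode : ∀ {n} → Tree n → Set
IsNode (leaf _)   = ⊥
IsNode (node _ _) = ⊤

RootedTree : ∀ {n} → Tree n → Set
RootedTree T = IsNode T × Unique (leaves T)

-- S is (the subtree below) a vertex of T
data SubtreeOf {n : ℕ} : Tree n → Tree n → Set where
  here  : ∀ {T} → SubtreeOf T T
  there : ∀ {S t ts p} → t ∈ ts → SubtreeOf S t → SubtreeOf S (node ts p)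

-- T displays xy|z: x,y,z are (distinct) leaves of T and some vertex v of T
-- has x,y below it but not z  (equivalently the x–y path avoids the
-- z–root path).
Displays : ∀ {n} → Tree n → Fin n → Fin n → Fin n → Set
Displays T x y z =
  x ≢ y × x ≢ z × y ≢ z ×
  x ∈ leaves T × y ∈ leaves T × z ∈ leaves T ×
  ∃[ S ] (SubtreeOf S T × x ∈ leaves S × y ∈ leaves S × z ∉ leaves S)

DisplaysAll : ∀ {n} → Tree n → List (Triple n) → Set
DisplaysAll T R = ∀ {t} → t ∈ R → Displays T (a t) (b t) (c t)

Consistent : ∀ {n} → List (Triple n) → Set
Consistent R = ∃[ T ] (RootedTree T × DisplaysAll T R)

LeafSetIsLR : ∀ {n} → Tree n → List (Triple n) → Set
LeafSetIsLR T R = ∀ x → (x ∈ leaves T → InLR R x) × (InLR R x → x ∈ leaves T)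

InCl : ∀ {n} → List (Triple n) → Fin n → Fin n → Fin n → Set
InCl R x y z = ∀ T → RootedTree T → LeafSetIsLR T R → DisplaysAll T R →
               Displays T x y z

AhoEdge : ∀ {n} → List (Triple n) → Subset n → Fin n → Fin n → Set
AhoEdge R L x y =
  x ∈ₛ L × y ∈ₛ L × x ≢ y × ∃[ z ] (z ∈ₛ L × TripleIn R x y z)

AhoReach : ∀ {n} → List (Triple n) → Subset n → Fin n → Fin n → Set
AhoReach R L = Star (AhoEdge R L)

IsComponent : ∀ {n} → List (Triple n) → Subset n → Subset n → Set
IsComponent R L C =
  Nonempty C × C ⊆ₛ L ×
  (∀ {x y} → x ∈ₛ C → y ∈ₛ C → AhoReach R L x y) ×
  (∀ {x y} → x ∈ₛ C → y ∈ₛ L → AhoReach R L x y → y ∈ₛ C)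

ExactlyTwoComponents : ∀ {n} → List (Triple n) → Subset n → Subset n → Subset n → Set
ExactlyTwoComponents R L A B =
  IsComponent R L A × IsComponent R L B × A ≢ B ×
  (∀ C → IsComponent R L C → C ≡ A ⊎ C ≡ B)

-- {A,B} ∈ 𝔏(ab|c;R), the unordered pair represented by an ordered pair
InFrakL : ∀ {n} → List (Triple n) → Fin n → Fin n → Fin n →
          Subset n → Subset n → Set
InFrakL R x y z A B =
  (∀ {v} → v ∈ₛ A → InLR R v) × (∀ {v} → v ∈ₛ B → InLR R v) ×
  ExactlyTwoComponents R (A ∪ B) A B ×
  ((x ∈ₛ A × y ∈ₛ A × z ∈ₛ B) ⊎ (x ∈ₛ B × y ∈ₛ B × z ∈ₛ A))

IsMaxFrakL : ∀ {n} → List (Triple n) → Fin n → Fin n → Fin n →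
             Subset n → Subset n → Set
IsMaxFrakL R x y z A* B* =
  InFrakL R x y z A* B* ×
  (∀ A B → InFrakL R x y z A B → ∣ A ∪ B ∣ ≤ ∣ A* ∪ B* ∣)

module Submission where

-- The proof follows the classical argument of Aho, Sagiv, Szymanski and
-- Ullman.  If a rooted tree T displays R, then for every set L of at least
-- two leaves of T the Aho graph [R, L] is disconnected: take the lowest
-- vertex V of T that has all of L below it and the child u of V above a
-- leaf x ∈ L; an edge pq of [R, L] comes from a triple pq|z with z ∈ L, the
-- vertex separating p,q from z then lies below u, so no path from x leaves
-- u, contradicting the minimality of V.
--
-- From this we derive that 𝔏(xy|z; R) is closed under componentwise union
-- of equally oriented pairs: with K₁ = A ∪ A′ and K₂ = B ∪ B′ both K₁ and
-- K₂ are connected, and they cannot be joined, since [R, K₁ ∪ K₂] would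
-- then be connected.  A pair {A*, B*} of maximum size therefore absorbs
-- every {A, B} ∈ 𝔏 (the union is no larger, hence equals {A*, B*}), which
-- is the first claim; uniqueness follows by applying it in both directions.

open import Defs
open import Data.Nat using (ℕ; _≤_)
open import Data.Nat.Properties using (<⇒≱)
open import Data.Fin using (Fin)
open import Data.Fin.Subset using (Subset; _⊆_; _∪_; ∣_∣)
  renaming (_∈_ to _∈ₛ_)
open import Data.Fin.Subset.Properties
  using (⊆-antisym; ⊆-trans; ⊆-reflexive; p⊂q⇒∣p∣<∣q∣; ∪-comm; p⊆p∪q; q⊆p∪q; x∈p∪q⁻)
  renaming (_∈?_ to _∈ₛ?_)
open import Data.List using (List; []; _∷_; _++_)
open import Data.List.Membership.Propositional using (_∈_; _∉_; find)
open import Data.List.Membership.Propositional.Properties using (∈-++⁺ˡ; ∈-++⁺ʳ; ∈-++⁻)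
open import Data.List.Relation.Unary.Any using (here; there)
import Data.List.Relation.Unary.Any as Any
open import Data.List.Relation.Unary.All using (All; []; _∷_)
import Data.List.Relation.Unary.All as All
open import Data.List.Relation.Unary.All.Properties using (++⁻ˡ)
open import Data.List.Relation.Unary.AllPairs using ([]; _∷_)
open import Data.List.Relation.Unary.Unique.Propositional using (Unique)
open import Data.Product using (_×_; _,_; proj₁; ∃-syntax)
import Data.Product as Product
open import Data.Sum using (_⊎_; inj₁; inj₂; [_,_])
import Data.Sum as Sum
open import Data.Empty using (⊥-elim)
open import Relation.Binary.PropositionalEquality using (_≡_; _≢_; refl; sym; subst)
open import Relation.Binary.Construct.Closure.ReflexiveTransitive using (ε; _◅_; _◅◅_; gmap)
import Relation.Binary.Construct.Closure.ReflexiveTransitive as Star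
open import Relation.Nullary using (¬_; yes; no)
open import Function using (_∘_; id)

module _ {A : Set} where

  unique-++⁻ˡ : ∀ (xs : List A) {ys} → Unique (xs ++ ys) → Unique xs
  unique-++⁻ˡ []       _          = []
  unique-++⁻ˡ (x ∷ xs) (x∉ ∷ uxs) = ++⁻ˡ xs x∉ ∷ unique-++⁻ˡ xs uxs

  unique-++⁻ʳ : ∀ (xs : List A) {ys} → Unique (xs ++ ys) → Unique ys
  unique-++⁻ʳ []       u         = u
  unique-++⁻ʳ (x ∷ xs) (_ ∷ uxs) = unique-++⁻ʳ xs uxs

  unique-++-disjoint : ∀ (xs : List A) {ys x} → Unique (xs ++ ys) → x ∈ xs → x ∉ ys
  unique-++-disjoint (_ ∷ xs) (x≢ ∷ _) (here refl) x∈ys = All.lookup x≢ (∈-++⁺ʳ xs x∈ys) refl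
  unique-++-disjoint (_ ∷ xs) (_ ∷ u)  (there x∈xs) x∈ys = unique-++-disjoint xs u x∈xs x∈ys

module _ {n : ℕ} where

  Below : Subset n → Tree n → Set
  Below L S = ∀ {v} → v ∈ₛ L → v ∈ leaves S

  ∈-leavesL⁺ : ∀ {t : Tree n} {ts x} → t ∈ ts → x ∈ leaves t → x ∈ leavesL ts
  ∈-leavesL⁺ {ts = _ ∷ _}  (here refl)  x∈t = ∈-++⁺ˡ x∈t
  ∈-leavesL⁺ {ts = t ∷ _}  (there t∈ts) x∈t = ∈-++⁺ʳ (leaves t) (∈-leavesL⁺ t∈ts x∈t)

  ∈-leavesL⁻ : ∀ (ts : List (Tree n)) {x} → x ∈ leavesL ts → ∃[ u ] (u ∈ ts × x ∈ leaves u)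
  ∈-leavesL⁻ (t ∷ ts) x∈ with ∈-++⁻ (leaves t) x∈
  ... | inj₁ x∈t  = t , here refl , x∈t
  ... | inj₂ x∈ts = let u , u∈ts , x∈u = ∈-leavesL⁻ ts x∈ts in u , there u∈ts , x∈u

  leaves-subtree : ∀ {S T : Tree n} {x} → SubtreeOf S T → x ∈ leaves S → x ∈ leaves T
  leaves-subtree here           x∈S = x∈S
  leaves-subtree (there t∈ts σ) x∈S = ∈-leavesL⁺ t∈ts (leaves-subtree σ x∈S)

  subtree-trans : ∀ {S U T : Tree n} → SubtreeOf S U → SubtreeOf U T → SubtreeOf S T
  subtree-trans σ here           = σ
  subtree-trans σ (there t∈ts π) = there t∈ts (subtree-trans σ π)

  unique-child : ∀ {ts : List (Tree n)} {t} → Unique (leavesL ts) → t ∈ ts → Unique (leaves t)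
  unique-child {t ∷ _} u (here refl)  = unique-++⁻ˡ (leaves t) u
  unique-child {t ∷ _} u (there t∈ts) = unique-child (unique-++⁻ʳ (leaves t) u) t∈ts

  unique-subtree : ∀ {S T : Tree n} → Unique (leaves T) → SubtreeOf S T → Unique (leaves S)
  unique-subtree u here           = u
  unique-subtree u (there t∈ts σ) = unique-subtree (unique-child u t∈ts) σ

  children-sharing-leaf : ∀ {ts : List (Tree n)} {u v x} → Unique (leavesL ts) →
                          u ∈ ts → v ∈ ts → x ∈ leaves u → x ∈ leaves v → u ≡ v
  children-sharing-leaf {t ∷ _} U (here refl) (here refl) _ _ = refl
  children-sharing-leaf {t ∷ _} U (here refl) (there v∈ts) x∈u x∈v =
    ⊥-elim (unique-++-disjoint (leaves t) U x∈u (∈-leavesL⁺ v∈ts x∈v))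
  children-sharing-leaf {t ∷ _} U (there u∈ts) (here refl) x∈u x∈v =
    ⊥-elim (unique-++-disjoint (leaves t) U x∈v (∈-leavesL⁺ u∈ts x∈u))
  children-sharing-leaf {t ∷ _} U (there u∈ts) (there v∈ts) x∈u x∈v =
    children-sharing-leaf (unique-++⁻ʳ (leaves t) U) u∈ts v∈ts x∈u x∈v

  nested : ∀ {T S₁ S₂ : Tree n} {p} → Unique (leaves T) → SubtreeOf S₁ T → SubtreeOf S₂ T →
           p ∈ leaves S₁ → p ∈ leaves S₂ → SubtreeOf S₁ S₂ ⊎ SubtreeOf S₂ S₁
  nested _  here σ₂   _ _ = inj₂ σ₂
  nested _  σ₁   here _ _ = inj₁ σ₁
  nested uT (there u∈ts σ₁) (there v∈ts σ₂) p∈S₁ p∈S₂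
    with children-sharing-leaf uT u∈ts v∈ts (leaves-subtree σ₁ p∈S₁) (leaves-subtree σ₂ p∈S₂)
  ... | refl = nested (unique-child uT u∈ts) σ₁ σ₂ p∈S₁ p∈S₂

  -- A vertex S sharing the leaf p with the child u of V but missing a leaf z
  -- of V lies below u: it is nested with V, and cannot contain V.
  below-child : ∀ {T S : Tree n} {ts pr u p z} → Unique (leaves T) →
                SubtreeOf S T → SubtreeOf (node ts pr) T → u ∈ ts →
                p ∈ leaves u → p ∈ leaves S → z ∈ leaves (node ts pr) → z ∉ leaves S →
                SubtreeOf S u
  below-child uT σ π u∈ts p∈u p∈S z∈V z∉S with nested uT σ π p∈S (∈-leavesL⁺ u∈ts p∈u)
  ... | inj₂ V⊑S = ⊥-elim (z∉S (leaves-subtree V⊑S z∈V))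
  ... | inj₁ here = ⊥-elim (z∉S z∈V)
  ... | inj₁ (there v∈ts S⊑v)
    with children-sharing-leaf (unique-subtree uT π) v∈ts u∈ts (leaves-subtree S⊑v p∈S) p∈u
  ...   | refl = S⊑v

  leaf-of-LR : ∀ {T} {R : List (Triple n)} {v} → DisplaysAll T R → InLR R v → v ∈ leaves T
  leaf-of-LR disp v∈LR with find v∈LR
  ... | t , t∈R , which with disp t∈R
  ... | _ , _ , _ , a∈T , b∈T , c∈T , _ with which
  ... | inj₁ refl         = a∈T
  ... | inj₂ (inj₁ refl)  = b∈T
  ... | inj₂ (inj₂ refl)  = c∈T

  separating-vertex : ∀ {T} {R : List (Triple n)} {p q z} → DisplaysAll T R → TripleIn R p q z →
                      ∃[ S ] (SubtreeOf S T × p ∈ leaves S × q ∈ leaves S × z ∉ leaves S)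
  separating-vertex disp pq∣z with find pq∣z
  ... | t , t∈R , order , refl with disp t∈R
  ... | _ , _ , _ , _ , _ , _ , S , σ , a∈S , b∈S , c∉S with order
  ... | inj₁ (refl , refl) = S , σ , a∈S , b∈S , c∉S
  ... | inj₂ (refl , refl) = S , σ , b∈S , a∈S , c∉S

module _ {n : ℕ} where

  ⊆-size-antisym : ∀ {p q : Subset n} → p ⊆ q → ∣ q ∣ ≤ ∣ p ∣ → p ≡ q
  ⊆-size-antisym {p} {q} p⊆q ∣q∣≤∣p∣ = ⊆-antisym p⊆q q⊆p
    where
    q⊆p : q ⊆ p
    q⊆p {x} x∈q with x ∈ₛ? p
    ... | yes x∈p = x∈p
    ... | no  x∉p = ⊥-elim (<⇒≱ (p⊂q⇒∣p∣<∣q∣ (p⊆q , x , x∈q , x∉p)) ∣q∣≤∣p∣)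

  ∪-mono : ∀ {p p′ q q′ : Subset n} → p ⊆ p′ → q ⊆ q′ → p ∪ q ⊆ p′ ∪ q′
  ∪-mono {p} {p′} {q} {q′} p⊆p′ q⊆q′ x∈p∪q with x∈p∪q⁻ p q x∈p∪q
  ... | inj₁ x∈p = p⊆p∪q q′ (p⊆p′ x∈p)
  ... | inj₂ x∈q = q⊆p∪q p′ q′ (q⊆q′ x∈q)

module _ {n : ℕ} (R : List (Triple n)) where

  reach-sym : ∀ {L x y} → AhoReach R L x y → AhoReach R L y x
  reach-sym = Star.reverse λ { (x∈L , y∈L , x≢y , z , z∈L , xy∣z) →
    y∈L , x∈L , x≢y ∘ sym , z , z∈L , Any.map (Product.map₁ Sum.swap) xy∣z }

  reach-mono : ∀ {L L′ x y} → L ⊆ L′ → AhoReach R L x y → AhoReach R L′ x y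
  reach-mono L⊆L′ = gmap id λ { (x∈L , y∈L , x≢y , z , z∈L , xy∣z) →
    L⊆L′ x∈L , L⊆L′ y∈L , x≢y , z , L⊆L′ z∈L , xy∣z }

  reach-within : ∀ {L L′ C x v} → IsComponent R L C → L ⊆ L′ →
                 x ∈ₛ C → v ∈ₛ C → AhoReach R L′ x v
  reach-within (_ , _ , connected , _) L⊆L′ x∈C v∈C = reach-mono L⊆L′ (connected x∈C v∈C)

  component-unique : ∀ {L C₁ C₂ x} → IsComponent R L C₁ → IsComponent R L C₂ →
                     x ∈ₛ C₁ → x ∈ₛ C₂ → C₁ ≡ C₂
  component-unique (_ , C₁⊆L , conn₁ , closed₁) (_ , C₂⊆L , conn₂ , closed₂) x∈C₁ x∈C₂ =
    ⊆-antisym (λ v∈C₁ → closed₂ x∈C₂ (C₁⊆L v∈C₁) (conn₁ x∈C₁ v∈C₁))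
              (λ v∈C₂ → closed₁ x∈C₁ (C₂⊆L v∈C₂) (conn₂ x∈C₂ v∈C₂))

  component-from : ∀ {L K x} → x ∈ₛ K → K ⊆ L →
                   (∀ {v} → v ∈ₛ K → AhoReach R L x v) →
                   (∀ {v} → v ∈ₛ L → AhoReach R L x v → v ∈ₛ K) → IsComponent R L K
  component-from x∈K K⊆L reach closed =
    (_ , x∈K) , K⊆L ,
    (λ p∈K q∈K → reach-sym (reach p∈K) ◅◅ reach q∈K) ,
    (λ p∈K q∈L p⇝q → closed q∈L (reach p∈K ◅◅ p⇝q))

  exactly-two : ∀ {K₁ K₂ x₁ x₂} → x₁ ∈ₛ K₁ → x₂ ∈ₛ K₂ →
                (∀ {v} → v ∈ₛ K₁ → AhoReach R (K₁ ∪ K₂) x₁ v) →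
                (∀ {v} → v ∈ₛ K₂ → AhoReach R (K₁ ∪ K₂) x₂ v) →
                ¬ AhoReach R (K₁ ∪ K₂) x₁ x₂ → ExactlyTwoComponents R (K₁ ∪ K₂) K₁ K₂
  exactly-two {K₁} {K₂} {x₁} {x₂} x₁∈K₁ x₂∈K₂ reach₁ reach₂ separated =
    comp₁ , comp₂ , K₁≢K₂ , only
    where
    comp₁ : IsComponent R (K₁ ∪ K₂) K₁
    comp₁ = component-from x₁∈K₁ (p⊆p∪q K₂) reach₁ closed
      where
      closed : ∀ {v} → v ∈ₛ K₁ ∪ K₂ → AhoReach R (K₁ ∪ K₂) x₁ v → v ∈ₛ K₁
      closed v∈L x₁⇝v with x∈p∪q⁻ K₁ K₂ v∈L
      ... | inj₁ v∈K₁ = v∈K₁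
      ... | inj₂ v∈K₂ = ⊥-elim (separated (x₁⇝v ◅◅ reach-sym (reach₂ v∈K₂)))
    comp₂ : IsComponent R (K₁ ∪ K₂) K₂
    comp₂ = component-from x₂∈K₂ (q⊆p∪q K₁ K₂) reach₂ closed
      where
      closed : ∀ {v} → v ∈ₛ K₁ ∪ K₂ → AhoReach R (K₁ ∪ K₂) x₂ v → v ∈ₛ K₂
      closed v∈L x₂⇝v with x∈p∪q⁻ K₁ K₂ v∈L
      ... | inj₁ v∈K₁ = ⊥-elim (separated (reach₁ v∈K₁ ◅◅ reach-sym x₂⇝v))
      ... | inj₂ v∈K₂ = v∈K₂
    K₁≢K₂ : K₁ ≢ K₂
    K₁≢K₂ K₁≡K₂ = separated (reach₁ (subst (x₂ ∈ₛ_) (sym K₁≡K₂) x₂∈K₂))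
    only : ∀ C → IsComponent R (K₁ ∪ K₂) C → C ≡ K₁ ⊎ C ≡ K₂
    only C compC@((v , v∈C) , C⊆L , _) with x∈p∪q⁻ K₁ K₂ (C⊆L v∈C)
    ... | inj₁ v∈K₁ = inj₁ (component-unique compC comp₁ v∈C v∈K₁)
    ... | inj₂ v∈K₂ = inj₂ (component-unique compC comp₂ v∈C v∈K₂)

module _ {n : ℕ} (R : List (Triple n)) {T : Tree n} (uT : Unique (leaves T))
         (disp : DisplaysAll T R) (L : Subset n) where

  -- Below a vertex V containing L, paths of [R, L] never leave a child u of V,
  -- since the vertex separating an edge's triple lies below u.
  reach-stays-in-child : ∀ {ts pr u p q} → SubtreeOf (node ts pr) T → Below L (node ts pr) →
                         u ∈ ts → AhoReach R L p q → p ∈ leaves u → q ∈ leaves u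
  reach-stays-in-child π L≤V u∈ts ε p∈u = p∈u
  reach-stays-in-child π L≤V u∈ts ((_ , _ , _ , z , z∈L , pq∣z) ◅ path) p∈u
    with separating-vertex disp pq∣z
  ... | S , σ , p∈S , q∈S , z∉S =
    reach-stays-in-child π L≤V u∈ts path
      (leaves-subtree (below-child uT σ π u∈ts p∈u p∈S (L≤V z∈L) z∉S) q∈S)

  aho-disconnected : ∀ {x y} → Below L T → x ∈ₛ L → y ∈ₛ L → x ≢ y →
                     ¬ (∀ {w} → w ∈ₛ L → AhoReach R L x w)
  aho-disconnected {x} {y} L≤T x∈L y∈L x≢y x⇝L = no-vertex-below T here L≤T
    where
    -- No vertex has all of L below it: at a leaf x = y, and at an inner
    -- vertex the child above x already has all of L below it.
    mutual
      no-vertex-below : ∀ S → SubtreeOf S T → ¬ Below L S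
      no-vertex-below (leaf _) _ L≤S with L≤S x∈L | L≤S y∈L
      ... | here refl | here refl = x≢y refl
      no-vertex-below (node ts pr) π L≤V with ∈-leavesL⁻ ts (L≤V x∈L)
      ... | u , u∈ts , x∈u =
        All.lookup (no-child-below ts) u∈ts (subtree-trans (there u∈ts here) π)
          (λ w∈L → reach-stays-in-child π L≤V u∈ts (x⇝L w∈L) x∈u)

      no-child-below : ∀ ts → All (λ u → SubtreeOf u T → ¬ Below L u) ts
      no-child-below []       = []
      no-child-below (t ∷ ts) = no-vertex-below t ∷ no-child-below ts

module _ {n : ℕ} (R : List (Triple n)) where

  consistent-disconnected : ∀ {L x y} → Consistent R → (∀ {v} → v ∈ₛ L → InLR R v) →
                            x ∈ₛ L → y ∈ₛ L → x ≢ y → ¬ (∀ {w} → w ∈ₛ L → AhoReach R L x w)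
  consistent-disconnected {L} (T , (_ , uT) , disp) L⊆LR =
    aho-disconnected R uT disp L (leaf-of-LR disp ∘ L⊆LR)

  frakL-distinct : ∀ {x y z A B} → InFrakL R x y z A B → A ≢ B
  frakL-distinct (_ , _ , (_ , _ , A≢B , _) , _) = A≢B

  frakL-swap : ∀ {x y z A B} → InFrakL R x y z A B → InFrakL R x y z B A
  frakL-swap {A = A} {B} (A⊆LR , B⊆LR , (compA , compB , A≢B , only) , orientation) =
    B⊆LR , A⊆LR ,
    subst (λ L → ExactlyTwoComponents R L B A) (∪-comm A B)
      (compB , compA , A≢B ∘ sym , λ C compC → Sum.swap (only C compC)) ,
    Sum.swap orientation

  maxFrakL-swap : ∀ {x y z A B} → IsMaxFrakL R x y z A B → IsMaxFrakL R x y z B A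
  maxFrakL-swap {A = A} {B} (inFrakL , largest) =
    frakL-swap inFrakL ,
    λ A′ B′ inFrakL′ → subst (λ K → ∣ A′ ∪ B′ ∣ ≤ ∣ K ∣) (∪-comm A B) (largest A′ B′ inFrakL′)

  frakL-union : ∀ {x y z A B A′ B′} → Consistent R →
                InFrakL R x y z A B → x ∈ₛ A → y ∈ₛ A → z ∈ₛ B →
                InFrakL R x y z A′ B′ → x ∈ₛ A′ → z ∈ₛ B′ →
                InFrakL R x y z (A ∪ A′) (B ∪ B′)
  frakL-union {x} {y} {z} {A} {B} {A′} {B′} cons
              frA@(A⊆LR , B⊆LR , (compA , compB , _ , _) , _) x∈A y∈A z∈B
              (A′⊆LR , B′⊆LR , (compA′ , compB′ , _ , _) , _) x∈A′ z∈B′ =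
    K₁⊆LR , K₂⊆LR , exactly-two R x∈K₁ z∈K₂ reach₁ reach₂ x↛z , inj₁ (x∈K₁ , y∈K₁ , z∈K₂)
    where
    K₁ K₂ L : Subset n
    K₁ = A ∪ A′
    K₂ = B ∪ B′
    L = K₁ ∪ K₂
    x∈K₁ : x ∈ₛ K₁
    x∈K₁ = p⊆p∪q A′ x∈A
    y∈K₁ : y ∈ₛ K₁
    y∈K₁ = p⊆p∪q A′ y∈A
    z∈K₂ : z ∈ₛ K₂
    z∈K₂ = p⊆p∪q B′ z∈B
    AB⊆L : A ∪ B ⊆ L
    AB⊆L = ∪-mono (p⊆p∪q A′) (p⊆p∪q B′)
    A′B′⊆L : A′ ∪ B′ ⊆ L
    A′B′⊆L = ∪-mono (q⊆p∪q A A′) (q⊆p∪q B B′)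
    reach₁ : ∀ {v} → v ∈ₛ K₁ → AhoReach R L x v
    reach₁ = [ reach-within R compA AB⊆L x∈A , reach-within R compA′ A′B′⊆L x∈A′ ]
             ∘ x∈p∪q⁻ A A′
    reach₂ : ∀ {v} → v ∈ₛ K₂ → AhoReach R L z v
    reach₂ = [ reach-within R compB AB⊆L z∈B , reach-within R compB′ A′B′⊆L z∈B′ ]
             ∘ x∈p∪q⁻ B B′
    K₁⊆LR : ∀ {v} → v ∈ₛ K₁ → InLR R v
    K₁⊆LR = [ A⊆LR , A′⊆LR ] ∘ x∈p∪q⁻ A A′
    K₂⊆LR : ∀ {v} → v ∈ₛ K₂ → InLR R v
    K₂⊆LR = [ B⊆LR , B′⊆LR ] ∘ x∈p∪q⁻ B B′
    x≢z : x ≢ z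
    x≢z refl = frakL-distinct frA (component-unique R compA compB x∈A z∈B)
    -- Joining x to z would make [R, L] connected, against Aho's lemma.
    x↛z : ¬ AhoReach R L x z
    x↛z x⇝z = consistent-disconnected cons ([ K₁⊆LR , K₂⊆LR ] ∘ x∈p∪q⁻ K₁ K₂)
      (p⊆p∪q K₂ x∈K₁) (q⊆p∪q K₁ K₂ z∈K₂) x≢z
      ([ reach₁ , (λ w∈K₂ → x⇝z ◅◅ reach₂ w∈K₂) ] ∘ x∈p∪q⁻ K₁ K₂)

  maximal-absorbs : ∀ {x y z A* B* K₁ K₂} → IsMaxFrakL R x y z A* B* → x ∈ₛ A* → z ∈ₛ B* →
                    InFrakL R x y z K₁ K₂ → x ∈ₛ K₁ → z ∈ₛ K₂ → A* ⊆ K₁ → B* ⊆ K₂ →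
                    K₁ ≡ A* × K₂ ≡ B*
  maximal-absorbs {A* = A*} {B*} {K₁} {K₂}
                  ((_ , _ , (compA* , compB* , _ , _) , _) , largest) x∈A* z∈B*
                  frK@(_ , _ , (compK₁ , compK₂ , _ , _) , _) x∈K₁ z∈K₂ A*⊆K₁ B*⊆K₂ =
    component-unique R (on-same-vertices compK₁) compA* x∈K₁ x∈A* ,
    component-unique R (on-same-vertices compK₂) compB* z∈K₂ z∈B*
    where
    same-vertices : A* ∪ B* ≡ K₁ ∪ K₂
    same-vertices = ⊆-size-antisym (∪-mono A*⊆K₁ B*⊆K₂) (largest K₁ K₂ frK)
    on-same-vertices : ∀ {C} → IsComponent R (K₁ ∪ K₂) C → IsComponent R (A* ∪ B*) C
    on-same-vertices = subst (λ L → IsComponent R L _) (sym same-vertices)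

  oriented-inside-maximal : ∀ {x y z A* B* A B} → Consistent R →
                            IsMaxFrakL R x y z A* B* → x ∈ₛ A* → z ∈ₛ B* →
                            InFrakL R x y z A B → x ∈ₛ A → y ∈ₛ A → z ∈ₛ B →
                            A ⊆ A* × B ⊆ B*
  oriented-inside-maximal {A* = A*} {B*} {A} {B} cons max x∈A* z∈B* frAB x∈A y∈A z∈B
    with maximal-absorbs max x∈A* z∈B*
           (frakL-union cons frAB x∈A y∈A z∈B (proj₁ max) x∈A* z∈B*)
           (p⊆p∪q A* x∈A) (p⊆p∪q B* z∈B) (q⊆p∪q A A*) (q⊆p∪q B B*)
  ... | A∪A*≡A* , B∪B*≡B* =
    ⊆-trans (p⊆p∪q A*) (⊆-reflexive A∪A*≡A*) , ⊆-trans (p⊆p∪q B*) (⊆-reflexive B∪B*≡B*)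

  inside-maximal : ∀ {x y z A* B* A B} → Consistent R → IsMaxFrakL R x y z A* B* →
                   InFrakL R x y z A B → (A ⊆ A* × B ⊆ B*) ⊎ (B ⊆ A* × A ⊆ B*)
  inside-maximal cons max@((_ , _ , _ , orientation*) , _) frAB@(_ , _ , _ , orientation)
    with orientation | orientation*
  ... | inj₁ (x∈A , y∈A , z∈B) | inj₁ (x∈A* , _ , z∈B*) =
    inj₁ (oriented-inside-maximal cons max x∈A* z∈B* frAB x∈A y∈A z∈B)
  ... | inj₂ (x∈B , y∈B , z∈A) | inj₁ (x∈A* , _ , z∈B*) =
    inj₂ (oriented-inside-maximal cons max x∈A* z∈B* (frakL-swap frAB) x∈B y∈B z∈A)
  ... | inj₁ (x∈A , y∈A , z∈B) | inj₂ (x∈B* , _ , z∈A*) =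
    inj₂ (Product.swap (oriented-inside-maximal cons (maxFrakL-swap max) x∈B* z∈A* frAB x∈A y∈A z∈B))
  ... | inj₂ (x∈B , y∈B , z∈A) | inj₂ (x∈B* , _ , z∈A*) =
    inj₁ (Product.swap
      (oriented-inside-maximal cons (maxFrakL-swap max) x∈B* z∈A* (frakL-swap frAB) x∈B y∈B z∈A))

pair-antisym : ∀ {n} {A B A′ B′ : Subset n} → A ≢ B →
               (A′ ⊆ A × B′ ⊆ B) ⊎ (B′ ⊆ A × A′ ⊆ B) →
               (A ⊆ A′ × B ⊆ B′) ⊎ (B ⊆ A′ × A ⊆ B′) →
               (A′ ≡ A × B′ ≡ B) ⊎ (A′ ≡ B × B′ ≡ A)
pair-antisym _   (inj₁ (A′⊆A , B′⊆B)) (inj₁ (A⊆A′ , B⊆B′)) = inj₁ (⊆-antisym A′⊆A A⊆A′ , ⊆-antisym B′⊆B B⊆B′)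
pair-antisym A≢B (inj₁ (A′⊆A , B′⊆B)) (inj₂ (B⊆A′ , A⊆B′)) = ⊥-elim (A≢B (⊆-antisym (B′⊆B ∘ A⊆B′) (A′⊆A ∘ B⊆A′)))
pair-antisym A≢B (inj₂ (B′⊆A , A′⊆B)) (inj₁ (A⊆A′ , B⊆B′)) = ⊥-elim (A≢B (⊆-antisym (A′⊆B ∘ A⊆A′) (B′⊆A ∘ B⊆B′)))
pair-antisym _   (inj₂ (B′⊆A , A′⊆B)) (inj₂ (B⊆A′ , A⊆B′)) = inj₂ (⊆-antisym A′⊆B B⊆A′ , ⊆-antisym B′⊆A A⊆B′)

mainTheorem12 : ∀ {n} (R : List (Triple n)) (a b c : Fin n) →
    Consistent R → InCl R a b c →
    (A* B* : Subset n) → IsMaxFrakL R a b c A* B* →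
    (∀ A B → InFrakL R a b c A B → (A ⊆ A* × B ⊆ B*) ⊎ (B ⊆ A* × A ⊆ B*))
    ×
    (∀ A′ B′ → IsMaxFrakL R a b c A′ B′ →
      (A′ ≡ A* × B′ ≡ B*) ⊎ (A′ ≡ B* × B′ ≡ A*))
mainTheorem12 R a b c cons _ A* B* max =
  (λ A B frAB → inside-maximal R cons max frAB) ,
  λ A′ B′ max′ → pair-antisym (frakL-distinct R (proj₁ max))
                   (inside-maximal R cons max (proj₁ max′))
                   (inside-maximal R cons max′ (proj₁ max))
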